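{- Let $n\geq 1$. If $\beta=(b_1,b_2,\ldots,b_n)\in[n]^n$ is a non-increasing vacillating parking function of length $n$ (i.e. $b_1\geq b_2\geq\cdots\geq b_n$), then $n-i\leq b_i\leq n+2-i$ for all $i\in[n]$.
   Context: For $n\in\mathbb{N}$ let $[n]=\{1,\dots,n\}$. A preference list $\alpha=(a_1,\dots,a_n)\in[n]^n$ describes $n$ cars entering, in order $i=1,\dots,n$, a one-way street with spots $1,\dots,n$; car $i$ prefers spot $a_i$. Under the vacillating parking rule, car $i$ parks in spot $a_i$ if unoccupied; otherwise in spot $a_i-1$ if it exists and is unoccupied; otherwise in spot $a_i+1$ if it exists and is unoccupied; otherwise it fails to park. If all cars park, $\alpha$ is a vacillating parking function of length $n$. -}

module Defs where

open import Data.Nat using (ℕ; zero; suc; _≤_; _≥_; _≤ᵇ_; _≡ᵇ_; _∸_; _+_)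
open import Data.Bool using (Bool; true; false; _∧_; not; if_then_else_)
open import Data.List using (List; []; _∷_)
open import Data.Bool.ListAction using (any)
open import Data.Maybe using (Maybe; just; nothing)
open import Data.Fin using (Fin; toℕ)
open import Data.Vec using (Vec; lookup; toList)
open import Relation.Binary.PropositionalEquality using (_≡_)
open import Data.Product using (_×_)

occupied : List ℕ → ℕ → Bool
occupied occ s = any (λ t → t ≡ᵇ s) occ

free : ℕ → List ℕ → ℕ → Bool
free n occ s = (1 ≤ᵇ s) ∧ (s ≤ᵇ n) ∧ not (occupied occ s)

parkSpot : ℕ → List ℕ → ℕ → Maybe ℕ
parkSpot n occ a =
  if free n occ a then just a
  else if free n occ (a ∸ 1) then just (a ∸ 1)
  else if free n occ (a + 1) then just (a + 1)
  else nothing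

allPark : ℕ → List ℕ → List ℕ → Bool
allPark n occ [] = true
allPark n occ (a ∷ as) with parkSpot n occ a
... | just s  = allPark n (s ∷ occ) as
... | nothing = false

-- α ∈ [n]^n, indexed by Fin n (index i ↦ car i+1).
InRange : (n : ℕ) → Vec ℕ n → Set
InRange n α = ∀ (i : Fin n) → (1 ≤ lookup α i) × (lookup α i ≤ n)

IsVacPF : (n : ℕ) → Vec ℕ n → Set
IsVacPF n α = InRange n α × (allPark n [] (toList α) ≡ true)

NonIncreasing : {n : ℕ} → Vec ℕ n → Set
NonIncreasing {n} α = ∀ (i j : Fin n) → toℕ i ≤ toℕ j → lookup α j ≤ lookup α i

-- Cars 1, …, i all prefer spots ≥ b_i, and the vacillating rule parks every car within one
-- spot of its preference, so these i cars fill i distinct spots of [b_i − 1, n]; likewise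
-- cars i, …, n all prefer spots ≤ b_i and fill n − i + 1 distinct spots of [1, b_i + 1].
-- Counting spots in the two intervals gives the two bounds.
module Submission where

open import Defs
open import Data.Nat using (ℕ; zero; suc; _≤_; _<_; _∸_; _+_; _⊓_; _≤ᵇ_; z≤n; s≤s; s≤s⁻¹)
open import Data.Nat.Properties
open import Data.Bool using (T; true; false; _∧_; not)
open import Data.Bool.Properties using (T-≡; T-∧; T-not-≡; T-∨)
open import Data.Fin using (Fin; toℕ) renaming (zero to fzero; suc to fsuc)
open import Data.Fin.Properties using (toℕ<n)
open import Data.Vec using (Vec; lookup; toList) renaming (_∷_ to _∷ᵥ_; [] to []ᵥ)
open import Data.Vec.Properties using (length-toList)
open import Data.List using (List; []; _∷_; length; take; drop; applyUpTo)
open import Data.List.Properties using (length-take; length-drop; length-applyUpTo; length-removeAt′)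
open import Data.List.Relation.Unary.All as All using (All; []; _∷_)
open import Data.List.Relation.Unary.Any using (here; there; _─_)
open import Data.List.Relation.Unary.Unique.Propositional using (Unique; []; _∷_)
import Data.List.Relation.Unary.Unique.Propositional.Properties as Unique
open import Data.List.Relation.Binary.Pointwise using (Pointwise; []; _∷_; Pointwise-length)
open import Data.List.Relation.Binary.Subset.Propositional using (_⊆_)
open import Data.List.Membership.Propositional using (_∈_; _∉_)
open import Data.List.Membership.Propositional.Properties using (∈-applyUpTo⁺)
open import Data.Maybe using (just; nothing)
open import Data.Product using (_×_; _,_; proj₁; proj₂; map₁)
open import Data.Sum using (inj₁; inj₂)
open import Function using (_∘_; Equivalence)
open import Relation.Nullary using (contradiction)
open import Relation.Binary.PropositionalEquality

private
  variable
    A B : Set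
    n lo hi p : ℕ
    occ : List ℕ

∈-─ : ∀ {x y} {ys : List A} (x∈ys : x ∈ ys) → y ∈ ys → y ≢ x → y ∈ (ys ─ x∈ys)
∈-─ (here refl) (here refl) y≢x = contradiction refl y≢x
∈-─ (here refl) (there y∈ys) _  = y∈ys
∈-─ (there x∈ys) (here refl) _  = here refl
∈-─ (there x∈ys) (there y∈ys) y≢x = there (∈-─ x∈ys y∈ys y≢x)

unique-⊆⇒length≤ : {xs ys : List A} → Unique xs → xs ⊆ ys → length xs ≤ length ys
unique-⊆⇒length≤ {xs = []} _ _ = z≤n
unique-⊆⇒length≤ {xs = x ∷ xs} {ys} (x≢xs ∷ uxs) xs⊆ys =
  subst (suc (length xs) ≤_) (sym (length-removeAt′ ys _))
    (s≤s (unique-⊆⇒length≤ uxs λ y∈xs →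
      ∈-─ x∈ys (xs⊆ys (there y∈xs)) (λ y≡x → All.lookup x≢xs y∈xs (sym y≡x))))
  where
  x∈ys : x ∈ ys
  x∈ys = xs⊆ys (here refl)

unique-between⇒length≤ : {xs : List ℕ} → Unique xs → All (λ x → lo ≤ x × x ≤ hi) xs →
  length xs ≤ suc hi ∸ lo
unique-between⇒length≤ {lo} {hi} uxs bounds =
  subst (_ ≤_) (length-applyUpTo (lo +_) (suc hi ∸ lo))
    (unique-⊆⇒length≤ uxs (λ x∈xs → inInterval (All.lookup bounds x∈xs)))
  where
  inInterval : ∀ {x} → lo ≤ x × x ≤ hi → x ∈ applyUpTo (lo +_) (suc hi ∸ lo)
  inInterval {x} (lo≤x , x≤hi) = subst (_∈ _) (m+[n∸m]≡n lo≤x)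
    (∈-applyUpTo⁺ (lo +_) (∸-monoˡ-< (s≤s x≤hi) lo≤x))

∈⇒occupied : ∀ {s} → s ∈ occ → T (occupied occ s)
∈⇒occupied {s = s} (here refl) = Equivalence.from T-∨ (inj₁ (≡⇒≡ᵇ s s refl))
∈⇒occupied (there s∈occ)       = Equivalence.from T-∨ (inj₂ (∈⇒occupied s∈occ))

free⇒vacant : ∀ {s} → free n occ s ≡ true → (1 ≤ s × s ≤ n) × s ∉ occ
free⇒vacant {n} {occ} {s} free≡true =
  (≤ᵇ⇒≤ 1 s T[1≤ᵇs] , ≤ᵇ⇒≤ s n T[s≤ᵇn]) ,
  λ s∈occ → subst T (Equivalence.to T-not-≡ T[¬occupied]) (∈⇒occupied s∈occ)
  where
  conjuncts : T (1 ≤ᵇ s) × T ((s ≤ᵇ n) ∧ not (occupied occ s))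
  conjuncts = Equivalence.to (T-∧ {1 ≤ᵇ s}) (Equivalence.from T-≡ free≡true)
  T[1≤ᵇs] : T (1 ≤ᵇ s)
  T[1≤ᵇs] = proj₁ conjuncts
  T[s≤ᵇn] : T (s ≤ᵇ n)
  T[s≤ᵇn] = proj₁ (Equivalence.to (T-∧ {s ≤ᵇ n}) (proj₂ conjuncts))
  T[¬occupied] : T (not (occupied occ s))
  T[¬occupied] = proj₂ (Equivalence.to (T-∧ {s ≤ᵇ n}) (proj₂ conjuncts))

ParksNear : ℕ → ℕ → ℕ → Set
ParksNear n a s = (a ∸ 1 ≤ s × s ≤ a + 1) × (1 ≤ s × s ≤ n)

free⇒ParksNear : ∀ {a s} → a ∸ 1 ≤ s × s ≤ a + 1 → free n occ s ≡ true → ParksNear n a s × s ∉ occ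
free⇒ParksNear nearA free[s] = map₁ (nearA ,_) (free⇒vacant free[s])

a∸1≤a+1 : ∀ a → a ∸ 1 ≤ a + 1
a∸1≤a+1 a = ≤-trans (m∸n≤m a 1) (m≤m+n a 1)

parkSpot-sound : ∀ {a s} → parkSpot n occ a ≡ just s → ParksNear n a s × s ∉ occ
parkSpot-sound {n} {occ} {a} parked with free n occ a in free[a]
... | true with refl ← parked = free⇒ParksNear (m∸n≤m a 1 , m≤m+n a 1) free[a]
... | false with free n occ (a ∸ 1) in free[a-1]
...   | true with refl ← parked = free⇒ParksNear (≤-refl , a∸1≤a+1 a) free[a-1]
...   | false with free n occ (a + 1) in free[a+1]
...     | true with refl ← parked = free⇒ParksNear (a∸1≤a+1 a , ≤-refl) free[a+1]
...     | false with () ← parked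

parkedSpots : ℕ → List ℕ → List ℕ → List ℕ
parkedSpots n occ [] = []
parkedSpots n occ (a ∷ as) with parkSpot n occ a
... | just s  = s ∷ parkedSpots n (s ∷ occ) as
... | nothing = []

parkedSpots-fresh : ∀ n occ as → Unique (parkedSpots n occ as) × All (_∉ occ) (parkedSpots n occ as)
parkedSpots-fresh n occ [] = [] , []
parkedSpots-fresh n occ (a ∷ as) with parkSpot n occ a in parked
... | nothing = [] , []
... | just s with unique , fresh ← parkedSpots-fresh n (s ∷ occ) as =
  All.map (λ t∉s∷occ s≡t → t∉s∷occ (here (sym s≡t))) fresh ∷ unique ,
  proj₂ (parkSpot-sound {n} {occ} {a} parked) ∷ All.map (_∘ there) fresh

parkedSpots-near : ∀ n occ as → allPark n occ as ≡ true → Pointwise (ParksNear n) as (parkedSpots n occ as)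
parkedSpots-near n occ [] _ = []
parkedSpots-near n occ (a ∷ as) parks with parkSpot n occ a in parked
... | just s = proj₁ (parkSpot-sound {n} {occ} {a} parked) ∷ parkedSpots-near n (s ∷ occ) as parks
... | nothing with () ← parks

Pointwise-take : ∀ {R : A → B → Set} {xs ys} k → Pointwise R xs ys → Pointwise R (take k xs) (take k ys)
Pointwise-take zero    _          = []
Pointwise-take (suc k) []         = []
Pointwise-take (suc k) (r ∷ rs)   = r ∷ Pointwise-take k rs

Pointwise-drop : ∀ {R : A → B → Set} {xs ys} k → Pointwise R xs ys → Pointwise R (drop k xs) (drop k ys)
Pointwise-drop zero    rs         = rs
Pointwise-drop (suc k) []         = []
Pointwise-drop (suc k) (_ ∷ rs)   = Pointwise-drop k rs

Pointwise-All : ∀ {R : A → B → Set} {P : A → Set} {Q : B → Set} {xs ys} →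
  (∀ {x y} → R x y → P x → Q y) → Pointwise R xs ys → All P xs → All Q ys
Pointwise-All R⇒ [] [] = []
Pointwise-All R⇒ (r ∷ rs) (px ∷ pxs) = R⇒ r px ∷ Pointwise-All R⇒ rs pxs

prefer≥⇒length≤ : ∀ {cs ss} → Pointwise (ParksNear n) cs ss → Unique ss → All (p ≤_) cs →
  length cs ≤ suc n ∸ (p ∸ 1)
prefer≥⇒length≤ {n} {p} near unique prefs =
  subst (_≤ _) (sym (Pointwise-length near))
    (unique-between⇒length≤ unique (Pointwise-All within near prefs))
  where
  within : ∀ {a s} → ParksNear n a s → p ≤ a → p ∸ 1 ≤ s × s ≤ n
  within ((a∸1≤s , _) , (_ , s≤n)) p≤a = ≤-trans (∸-monoˡ-≤ 1 p≤a) a∸1≤s , s≤n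

prefer≤⇒length≤ : ∀ {cs ss} → Pointwise (ParksNear n) cs ss → Unique ss → All (_≤ p) cs →
  length cs ≤ suc p
prefer≤⇒length≤ {n} {p} near unique prefs =
  subst (_≤ _) (sym (Pointwise-length near))
    (unique-between⇒length≤ unique (Pointwise-All within near prefs))
  where
  within : ∀ {a s} → ParksNear n a s → a ≤ p → 1 ≤ s × s ≤ suc p
  within ((_ , s≤a+1) , (1≤s , _)) a≤p =
    1≤s , ≤-trans s≤a+1 (≤-trans (+-monoˡ-≤ 1 a≤p) (≤-reflexive (+-comm p 1)))

All-take-toList : ∀ {P : A → Set} {m} (v : Vec A m) k →
  (∀ j → toℕ j < k → P (lookup v j)) → All P (take k (toList v))
All-take-toList []ᵥ       zero    _ = []
All-take-toList []ᵥ       (suc k) _ = []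
All-take-toList (x ∷ᵥ v) zero    _ = []
All-take-toList (x ∷ᵥ v) (suc k) p = p fzero (s≤s z≤n) ∷ All-take-toList v k (λ j j<k → p (fsuc j) (s≤s j<k))

All-drop-toList : ∀ {P : A → Set} {m} (v : Vec A m) k →
  (∀ j → k ≤ toℕ j → P (lookup v j)) → All P (drop k (toList v))
All-drop-toList []ᵥ       zero    _ = []
All-drop-toList []ᵥ       (suc k) _ = []
All-drop-toList (x ∷ᵥ v) zero    p = p fzero z≤n ∷ All-drop-toList v zero (λ j _ → p (fsuc j) z≤n)
All-drop-toList (x ∷ᵥ v) (suc k) p = All-drop-toList v k (λ j k≤j → p (fsuc j) (s≤s k≤j))

1+k≤1+n∸[b∸1]⇒b≤n+1∸k : ∀ {n k} b → suc k ≤ suc n ∸ (b ∸ 1) → b ≤ n + 1 ∸ k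
1+k≤1+n∸[b∸1]⇒b≤n+1∸k zero _ = z≤n
1+k≤1+n∸[b∸1]⇒b≤n+1∸k {n} {k} (suc c) 1+k≤1+n∸c = m+n≤o⇒m≤o∸n (suc c) (begin
  suc c + k  ≡⟨ cong suc (+-comm c k) ⟩
  suc k + c  ≤⟨ m≤o∸n⇒m+n≤o (suc k) c≤1+n 1+k≤1+n∸c ⟩
  suc n      ≡⟨ +-comm 1 n ⟩
  n + 1      ∎)
  where
  open ≤-Reasoning
  c≤1+n : c ≤ suc n
  c≤1+n = <⇒≤ (m∸n≢0⇒n<m λ 1+n∸c≡0 → contradiction (subst (suc k ≤_) 1+n∸c≡0 1+k≤1+n∸c) λ ())

lemma3p5 : (n : ℕ) → 1 ≤ n → (β : Vec ℕ n) → IsVacPF n β → NonIncreasing β →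
    (i : Fin n) → (n ∸ suc (toℕ i) ≤ lookup β i) × (lookup β i ≤ n + 1 ∸ toℕ i)
lemma3p5 n _ β (_ , parks) nonIncreasing i = lower , upper
  where
  cars : List ℕ
  cars = toList β
  k b : ℕ
  k = toℕ i
  b = lookup β i

  near : Pointwise (ParksNear n) cars (parkedSpots n [] cars)
  near = parkedSpots-near n [] cars parks

  distinct : Unique (parkedSpots n [] cars)
  distinct = proj₁ (parkedSpots-fresh n [] cars)

  length-prefix : length (take (suc k) cars) ≡ suc k
  length-prefix = trans (length-take (suc k) cars)
    (trans (cong (suc k ⊓_) (length-toList β)) (m≤n⇒m⊓n≡m (toℕ<n i)))

  length-suffix : length (drop k cars) ≡ n ∸ k
  length-suffix = trans (length-drop k cars) (cong (_∸ k) (length-toList β))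

  upper : b ≤ n + 1 ∸ k
  upper = 1+k≤1+n∸[b∸1]⇒b≤n+1∸k b (subst (_≤ suc n ∸ (b ∸ 1)) length-prefix
    (prefer≥⇒length≤ (Pointwise-take (suc k) near) (Unique.take⁺ (suc k) distinct)
      (All-take-toList β (suc k) λ j j<1+k → nonIncreasing j i (s≤s⁻¹ j<1+k))))

  lower : n ∸ suc k ≤ b
  lower = subst (_≤ b) (pred[m∸n]≡m∸[1+n] n k) (pred-mono-≤ (subst (_≤ suc b) length-suffix
    (prefer≤⇒length≤ (Pointwise-drop k near) (Unique.drop⁺ k distinct)
      (All-drop-toList β k (nonIncreasing i)))))
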